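{- If $H$ and $T$ are non-empty trees such that $H\succcurlyeq T$, then $v(H)\geq v(T)$.
   Context: All graphs are finite, simple and undirected; a graph is non-empty if it has at least one edge; $v(\cdot)$, $e(\cdot)$ denote numbers of vertices and edges. $t(H,G)=\hom(H,G)/v(G)^{v(H)}$, where $\hom(H,G)$ is the number of graph homomorphisms from $H$ to $G$. For non-empty graphs $H,T$, $H\succcurlyeq T$ means $t(H,G)^{e(T)}\geq t(T,G)^{e(H)}$ for every graph $G$. -}

module Defs where

open import Data.Nat using (ℕ; zero; suc; _+_; _*_; _^_; _≤_; _<ᵇ_)
open import Data.Bool using (Bool; true; false; _∧_; _∨_; not; if_then_else_)
open import Data.Fin using (Fin; toℕ; inject₁; fromℕ)
open import Data.List using (List; []; _∷_; map; concatMap; allFin; length; filter)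
open import Data.Nat.ListAction using (sum)
open import Data.Bool.ListAction using (and)
open import Data.Vec.Functional as VF using ()
open import Data.Product using (Σ; _×_)
open import Relation.Nullary using (¬_)
open import Relation.Binary.PropositionalEquality using (_≡_)
open import Function.Definitions using (Injective)

record Graph : Set where
  field
    n      : ℕ
    adj    : Fin n → Fin n → Bool
    sym    : ∀ i j → adj i j ≡ adj j i
    irrefl : ∀ i → adj i i ≡ false
open Graph public

v : Graph → ℕ
v G = n G

e : Graph → ℕ
e G = sum (concatMap (λ i → map (λ j → if (toℕ i <ᵇ toℕ j) ∧ adj G i j then 1 else 0)
                                (allFin (n G)))
                     (allFin (n G)))

allMaps : (k m : ℕ) → List (Fin k → Fin m)
allMaps zero    m = (λ ()) ∷ []
allMaps (suc k) m = concatMap (λ a → map (λ f → a VF.∷ f) (allMaps k m)) (allFin m)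

isHom : (H G : Graph) → (Fin (n H) → Fin (n G)) → Bool
isHom H G f = and (concatMap (λ i → map (λ j → not (adj H i j) ∨ adj G (f i) (f j))
                                        (allFin (n H)))
                             (allFin (n H)))

hom : Graph → Graph → ℕ
hom H G = length (filter (λ f → isHom H G f ≡? true) (allMaps (n H) (n G)))
  where
  open import Data.Bool.Properties using () renaming (_≟_ to _≡?_)

data Walk (G : Graph) : Fin (n G) → Fin (n G) → Set where
  here : ∀ {i} → Walk G i i
  step : ∀ {i j k} → adj G i j ≡ true → Walk G j k → Walk G i k

Connected : Graph → Set
Connected G = ∀ i j → Walk G i j

HasCycle : Graph → Set
HasCycle G = Σ ℕ λ k → Σ (Fin (suc (suc (suc k))) → Fin (n G)) λ c →
  Injective _≡_ _≡_ c ×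
  (∀ (i : Fin (suc (suc k))) → adj G (c (inject₁ i)) (c (Fin.suc i)) ≡ true) ×
  (adj G (c (fromℕ (suc (suc k)))) (c Fin.zero) ≡ true)

Tree : Graph → Set
Tree G = Connected G × ¬ HasCycle G

NonEmpty : Graph → Set
NonEmpty G = 1 ≤ e G

-- H ≽ T : t(H,G)^{e(T)} ≥ t(T,G)^{e(H)} for every graph G, with
-- t(H,G) = hom(H,G)/v(G)^{v(H)}, written after clearing the (positive) denominators.
_≽_ : Graph → Graph → Set
H ≽ T = ∀ (G : Graph) →
  hom T G ^ e H * v G ^ (v H * e T) ≤ hom H G ^ e T * v G ^ (v T * e H)

-- Suppose v(T) > v(H) and test H ≽ T on G = K_{v(T)} padded with isolated vertices to M
-- vertices. T embeds in G, so hom(T,G) ≥ 1; H has no isolated vertex, so every homomorphism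
-- lands in the clique and hom(H,G) ≤ v(T)^{v(H)}. For trees e = v − 1, so the powers of M in
-- H ≽ T are M^{v(H) e(T)} against M^{v(T) e(H)}, whose exponents differ by v(T) − v(H) > 0;
-- for M large the inequality fails.
-- The edge count of a tree comes from layering the vertices by their distance to a root:
-- a cycle would arise from an edge inside a layer or from a vertex with two neighbours in the
-- layer above, so the edges correspond to the non-root vertices via their unique parent.

module Submission where

open import Defs hiding (sym)

open import Data.Bool using (Bool; true; false; _∧_; _∨_; not; if_then_else_; T)
open import Data.Bool.ListAction using (and)
open import Data.Bool.Properties using (∧-zeroʳ; ∧-assoc; ∧-comm; ∧-conicalˡ; T-≡) renaming (_≟_ to _≟ᵇ_)
open import Data.Empty using (⊥-elim)
open import Data.Fin as Fin using (Fin; toℕ; punchIn; inject₁; fromℕ)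
open import Data.Fin.Properties
  using (any?; punchInᵢ≢i; toℕ-injective; toℕ<n; toℕ-inject≤; inject≤-injective)
open import Data.List using (List; []; _∷_; _++_; map; concatMap; tabulate; allFin; length; filter)
open import Data.List.Properties using (map-tabulate; map-id; map-++; map-∘)
open import Data.List.Relation.Unary.All using (All)
open import Data.List.Relation.Unary.All.Properties
  using (all⁺; all⁻; concat⁺; concat⁻; map⁺; map⁻; tabulate⁺; tabulate⁻)
open import Data.Nat as ℕ using (ℕ; zero; suc; _+_; _*_; _^_; _≤_; _<_; _≥_; z≤n; s≤s; z<s; _<ᵇ_; _<?_)
open import Data.Nat.ListAction using (sum)
open import Data.Nat.ListAction.Properties using (sum-++)
open import Data.Nat.Properties
  using ( +-0-commutativeMonoid; +-identityʳ; +-mono-≤; *-cancelˡ-≡; *-monoˡ-≤; *-monoˡ-<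
        ; ^-monoˡ-≤; ^-zeroˡ; ^-*-assoc; ^-distribˡ-+-*; m^n≢0
        ; ≤-refl; ≤-reflexive; ≤-trans; ≤-antisym; ≤-pred; <-cmp; <⇒≱; ≮⇒≥; ≰⇒>; <ᵇ⇒<
        ; 1+n≰n; 1+n≢n; 1+n≢0; n≤1+n; m≤m+n; m≤m*n; m≤n*m; m<n+m
        ; m<1+n⇒m<n∨m≡n; m≤n⇒∃[o]m+o≡n; module ≤-Reasoning)
open import Data.Nat.Tactic.RingSolver using (solve-∀)
open import Algebra.Properties.CommutativeMonoid.Sum +-0-commutativeMonoid
  using (sum-syntax; sum-cong-≗; sum-remove; sum-replicate-zero; ∑-distrib-+; ∑-comm)
  renaming (sum to ∑)
open import Data.Product using (Σ; ∃; _×_; _,_; proj₁; proj₂)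
open import Data.Sum using (_⊎_; inj₁; inj₂; [_,_]′)
open import Data.Unit using (⊤; tt)
open import Data.Vec.Functional as Vector using ()
open import Function using (_∘_; id)
open import Function.Bundles using (Equivalence; mk⇔)
open import Relation.Binary using (tri<; tri≈; tri>)
open import Relation.Binary.PropositionalEquality
  using (_≡_; _≢_; refl; sym; trans; cong; cong₂; subst; subst₂; module ≡-Reasoning)
open import Relation.Nullary using (¬_; does; yes; no; contradiction)
open import Relation.Nullary.Decidable using (T?; dec-true; dec-false; does-⇔)

[_] : Bool → ℕ
[ b ] = if b then 1 else 0

∑-zero : ∀ {n} {f : Fin n → ℕ} → (∀ i → f i ≡ 0) → ∑ f ≡ 0
∑-zero {n} f≗0 = trans (sum-cong-≗ f≗0) (sum-replicate-zero n)

∑-ones : ∀ {n} {f : Fin n → ℕ} → (∀ i → f i ≡ 1) → ∑ f ≡ n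
∑-ones {zero}  _   = refl
∑-ones {suc n} f≗1 = cong₂ _+_ (f≗1 Fin.zero) (∑-ones (f≗1 ∘ Fin.suc))

∑-single : ∀ {n} (f : Fin n → ℕ) r → (∀ i → i ≢ r → f i ≡ 0) → ∑ f ≡ f r
∑-single {suc n} f r off = begin
  ∑ f                                   ≡⟨ sum-remove {i = r} f ⟩
  f r + ∑[ i < n ] f (punchIn r i)      ≡⟨ cong (f r +_) (∑-zero (λ i → off _ (punchInᵢ≢i r i))) ⟩
  f r + 0                               ≡⟨ +-identityʳ (f r) ⟩
  f r                                   ∎
  where open ≡-Reasoning

∑-all-but-one : ∀ {n} (f : Fin n → ℕ) r → f r ≡ 0 → (∀ i → i ≢ r → f i ≡ 1) → suc (∑ f) ≡ n
∑-all-but-one {suc n} f r fr≡0 off =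
  cong suc (trans (sum-remove {i = r} f) (cong₂ _+_ fr≡0 (∑-ones (λ i → off _ (punchInᵢ≢i r i)))))

term≤∑ : ∀ {n} (f : Fin n → ℕ) i → f i ≤ ∑ f
term≤∑ {suc n} f i = subst (f i ≤_) (sym (sum-remove {i = i} f)) (m≤m+n _ _)

sum-tabulate : ∀ {n} (f : Fin n → ℕ) → sum (tabulate f) ≡ ∑ f
sum-tabulate {zero}  f = refl
sum-tabulate {suc n} f = cong (f Fin.zero +_) (sum-tabulate (f ∘ Fin.suc))

sum-map-allFin : ∀ {n} (f : Fin n → ℕ) → sum (map f (allFin n)) ≡ ∑ f
sum-map-allFin f = trans (cong sum (map-tabulate id f)) (sum-tabulate f)

sum-concatMap : ∀ {A : Set} (f : A → List ℕ) xs → sum (concatMap f xs) ≡ sum (map (sum ∘ f) xs)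
sum-concatMap f []       = refl
sum-concatMap f (x ∷ xs) = trans (sum-++ (f x) _) (cong (sum (f x) +_) (sum-concatMap f xs))

-- Counting edges

module EdgeCount (G : Graph) where

  private
    N : ℕ
    N = n G

    _≺_ : Fin N → Fin N → Bool
    i ≺ j = toℕ i <ᵇ toℕ j

  e-as-∑ : e G ≡ ∑[ i < N ] ∑[ j < N ] [ i ≺ j ∧ adj G i j ]
  e-as-∑ = begin
    e G                                                   ≡⟨ sum-concatMap rows (allFin N) ⟩
    sum (map (sum ∘ rows) (allFin N))                     ≡⟨ sum-map-allFin (sum ∘ rows) ⟩
    ∑[ i < N ] sum (rows i)                               ≡⟨ sum-cong-≗ (λ i → sum-map-allFin (entry i)) ⟩
    ∑[ i < N ] ∑[ j < N ] [ i ≺ j ∧ adj G i j ]           ∎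
    where
    open ≡-Reasoning
    entry : Fin N → Fin N → ℕ
    entry i j = [ i ≺ j ∧ adj G i j ]
    rows : Fin N → List ℕ
    rows i = map (entry i) (allFin N)

  adj-split : ∀ i j → [ adj G i j ] ≡ [ i ≺ j ∧ adj G i j ] + [ j ≺ i ∧ adj G j i ]
  -- does (m <? n) reduces to m <ᵇ n, so dec-true and dec-false evaluate _≺_.
  adj-split i j with <-cmp (toℕ i) (toℕ j)
  ... | tri< i<j _ j≮i
    rewrite dec-true (toℕ i <? toℕ j) i<j | dec-false (toℕ j <? toℕ i) j≮i
    = sym (+-identityʳ _)
  ... | tri> i≮j _ j<i
    rewrite dec-false (toℕ i <? toℕ j) i≮j | dec-true (toℕ j <? toℕ i) j<i | Graph.sym G i j
    = refl
  ... | tri≈ _ i≡j _ with toℕ-injective i≡j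
  ...   | refl rewrite irrefl G i | ∧-zeroʳ (i ≺ i) = refl

  handshake : ∑[ i < N ] ∑[ j < N ] [ adj G i j ] ≡ e G + e G
  handshake = begin
    ∑[ i < N ] ∑[ j < N ] [ adj G i j ]
      ≡⟨ sum-cong-≗ (λ i → trans (sum-cong-≗ (adj-split i)) (∑-distrib-+ (below i) (above i))) ⟩
    ∑[ i < N ] (∑[ j < N ] below i j + ∑[ j < N ] above i j)
      ≡⟨ ∑-distrib-+ (λ i → ∑[ j < N ] below i j) (λ i → ∑[ j < N ] above i j) ⟩
    ∑[ i < N ] ∑[ j < N ] below i j + ∑[ i < N ] ∑[ j < N ] below j i
      ≡⟨ cong (∑[ i < N ] ∑[ j < N ] below i j +_) (∑-comm (λ i j → below j i)) ⟩
    ∑[ i < N ] ∑[ j < N ] below i j + ∑[ j < N ] ∑[ i < N ] below j i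
      ≡⟨ cong₂ _+_ (sym e-as-∑) (sym e-as-∑) ⟩
    e G + e G ∎
    where
    open ≡-Reasoning
    below above : Fin N → Fin N → ℕ
    below i j = [ i ≺ j ∧ adj G i j ]
    above i j = below j i

-- Counting homomorphisms

Homomorphism : (H G : Graph) → (Fin (n H) → Fin (n G)) → Set
Homomorphism H G f = ∀ i j → adj H i j ≡ true → adj G (f i) (f j) ≡ true

module _ {H G : Graph} {f : Fin (n H) → Fin (n G)} where

  private
    respects : Fin (n H) → Fin (n H) → Bool
    respects i j = not (adj H i j) ∨ adj G (f i) (f j)

    checks : List Bool
    checks = concatMap (λ i → map (respects i) (allFin (n H))) (allFin (n H))

    and-checks : and checks ≡ and (map id checks)
    and-checks = cong and (sym (map-id checks))

    T-implication⁺ : ∀ {a b} → (a ≡ true → b ≡ true) → T (not a ∨ b)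
    T-implication⁺ {false}         _   = _
    T-implication⁺ {true}  {true}  _   = _
    T-implication⁺ {true}  {false} a⇒b with () ← a⇒b refl

    T-implication⁻ : ∀ {a b} → T (not a ∨ b) → a ≡ true → b ≡ true
    T-implication⁻ {true} {true} _ _ = refl

  isHom-sound : isHom H G f ≡ true → Homomorphism H G f
  isHom-sound isHom≡true i j =
    T-implication⁻ (tabulate⁻ (map⁻ (tabulate⁻ (map⁻ (concat⁻ allChecks)) i)) j)
    where
    allChecks : All T checks
    allChecks = all⁺ id checks (Equivalence.from T-≡ (trans (sym and-checks) isHom≡true))

  isHom-complete : Homomorphism H G f → isHom H G f ≡ true
  isHom-complete hom = trans and-checks (Equivalence.to T-≡ (all⁻ id allChecks))
    where
    allChecks : All T checks
    allChecks = concat⁺ (map⁺ (tabulate⁺ (λ i → map⁺ (tabulate⁺ (λ j → T-implication⁺ (hom i j))))))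

count : {A : Set} → (A → Bool) → List A → ℕ
count p xs = sum (map ([_] ∘ p) xs)

length-filter≡count : ∀ {A : Set} (p : A → Bool) xs → length (filter (λ x → p x ≟ᵇ true) xs) ≡ count p xs
length-filter≡count p []       = refl
length-filter≡count p (x ∷ xs) with p x
... | true  = cong suc (length-filter≡count p xs)
... | false = length-filter≡count p xs

count-concatMap : ∀ {A B : Set} (p : B → Bool) (f : A → List B) xs →
  count p (concatMap f xs) ≡ sum (map (count p ∘ f) xs)
count-concatMap p f []       = refl
count-concatMap p f (x ∷ xs) = begin
  sum (map ([_] ∘ p) (f x ++ concatMap f xs))       ≡⟨ cong sum (map-++ ([_] ∘ p) (f x) _) ⟩
  sum (map ([_] ∘ p) (f x) ++ map ([_] ∘ p) _)      ≡⟨ sum-++ (map ([_] ∘ p) (f x)) _ ⟩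
  count p (f x) + count p (concatMap f xs)          ≡⟨ cong (count p (f x) +_) (count-concatMap p f xs) ⟩
  count p (f x) + sum (map (count p ∘ f) xs)        ∎
  where open ≡-Reasoning

count-map : ∀ {A B : Set} (p : B → Bool) (f : A → B) xs → count p (map f xs) ≡ count (p ∘ f) xs
count-map p f xs = cong sum (sym (map-∘ xs))

count-allMaps-suc : ∀ k m (p : (Fin (suc k) → Fin m) → Bool) →
  count p (allMaps (suc k) m) ≡ ∑[ a < m ] count (λ g → p (a Vector.∷ g)) (allMaps k m)
count-allMaps-suc k m p = begin
  count p (allMaps (suc k) m)
    ≡⟨ count-concatMap p _ (allFin m) ⟩
  sum (map (λ a → count p (map (a Vector.∷_) (allMaps k m))) (allFin m))
    ≡⟨ sum-map-allFin (λ a → count p (map (a Vector.∷_) (allMaps k m))) ⟩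
  ∑[ a < m ] count p (map (a Vector.∷_) (allMaps k m))
    ≡⟨ sum-cong-≗ (λ a → count-map p (a Vector.∷_) (allMaps k m)) ⟩
  ∑[ a < m ] count (λ g → p (a Vector.∷ g)) (allMaps k m) ∎
  where open ≡-Reasoning

count-none : ∀ {A : Set} (p : A → Bool) xs → (∀ x → p x ≢ true) → count p xs ≡ 0
count-none p []       never = refl
count-none p (x ∷ xs) never with p x in px
... | true  = ⊥-elim (never x px)
... | false = count-none p xs never

∑-supported-below : ∀ {M} b {c} (f : Fin M → ℕ) → (∀ a → f a ≤ c) → (∀ a → b ≤ toℕ a → f a ≡ 0) →
  ∑[ a < M ] f a ≤ b * c
∑-supported-below {zero}  b       f f≤c vanish = z≤n
∑-supported-below {suc M} zero    f f≤c vanish = ≤-reflexive (∑-zero (λ a → vanish a z≤n))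
∑-supported-below {suc M} (suc b) f f≤c vanish =
  +-mono-≤ (f≤c Fin.zero) (∑-supported-below b (f ∘ Fin.suc) (f≤c ∘ Fin.suc) (λ a b≤a → vanish (Fin.suc a) (s≤s b≤a)))

count-allMaps-pos : ∀ k m (p : (Fin k → Fin m) → Bool) (f : Fin k → Fin m) →
  (∀ g → (∀ i → g i ≡ f i) → p g ≡ true) → 1 ≤ count p (allMaps k m)
count-allMaps-pos zero    m p f p≗ = singleton-pos (p≗ _ (λ ()))
  where
  singleton-pos : ∀ {b} → b ≡ true → 1 ≤ [ b ] + 0
  singleton-pos refl = s≤s z≤n
count-allMaps-pos (suc k) m p f p≗ rewrite count-allMaps-suc k m p =
  ≤-trans (count-allMaps-pos k m (λ g → p (f Fin.zero Vector.∷ g)) (f ∘ Fin.suc) extend)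
          (term≤∑ (λ a → count (λ g → p (a Vector.∷ g)) (allMaps k m)) (f Fin.zero))
  where
  extend : ∀ g → (∀ i → g i ≡ f (Fin.suc i)) → p (f Fin.zero Vector.∷ g) ≡ true
  extend g g≗ = p≗ _ λ { Fin.zero → refl ; (Fin.suc i) → g≗ i }

count-allMaps-≤ : ∀ k m b (p : (Fin k → Fin m) → Bool) → (∀ g → p g ≡ true → ∀ i → toℕ (g i) < b) →
  count p (allMaps k m) ≤ b ^ k
count-allMaps-≤ zero    m b p _     = singleton-≤ (p _)
  where
  singleton-≤ : ∀ x → [ x ] + 0 ≤ 1
  singleton-≤ true  = ≤-refl
  singleton-≤ false = z≤n
count-allMaps-≤ (suc k) m b p below rewrite count-allMaps-suc k m p =
  ∑-supported-below b (λ a → count (pₐ a) (allMaps k m))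
    (λ a → count-allMaps-≤ k m b (pₐ a) (λ g pg i → below _ pg (Fin.suc i)))
    (λ a b≤a → count-none (pₐ a) (allMaps k m) (λ g pg → <⇒≱ (below _ pg Fin.zero) b≤a))
  where
  pₐ : Fin m → (Fin k → Fin m) → Bool
  pₐ a g = p (a Vector.∷ g)

hom≡count : ∀ H G → hom H G ≡ count (isHom H G) (allMaps (n H) (n G))
hom≡count H G = length-filter≡count (isHom H G) (allMaps (n H) (n G))

hom-pos : ∀ H G (f : Fin (n H) → Fin (n G)) → Homomorphism H G f → 1 ≤ hom H G
hom-pos H G f f-hom = subst (1 ≤_) (sym (hom≡count H G))
  (count-allMaps-pos (n H) (n G) (isHom H G) f (λ g g≗f → isHom-complete {H} {G} {g} (g-hom g g≗f)))
  where
  g-hom : ∀ g → (∀ i → g i ≡ f i) → Homomorphism H G g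
  g-hom g g≗f i j a = subst₂ (λ x y → adj G x y ≡ true) (sym (g≗f i)) (sym (g≗f j)) (f-hom i j a)

hom-≤ : ∀ H G b → (∀ f → Homomorphism H G f → ∀ i → toℕ (f i) < b) → hom H G ≤ b ^ n H
hom-≤ H G b below = subst (_≤ b ^ n H) (sym (hom≡count H G))
  (count-allMaps-≤ (n H) (n G) b (isHom H G) (λ f → below f ∘ isHom-sound {H} {G} {f}))

adj⇒≢ : ∀ G {i j} → adj G i j ≡ true → i ≢ j
adj⇒≢ G {i} ij refl with () ← trans (sym ij) (irrefl G i)

clique : ℕ → ℕ → Graph
clique m M = record { n = M ; adj = edge ; sym = edge-sym ; irrefl = edge-irrefl }
  where
  edge : Fin M → Fin M → Bool
  edge i j = does (toℕ i <? m) ∧ does (toℕ j <? m) ∧ not (does (i Fin.≟ j))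

  edge-sym : ∀ i j → edge i j ≡ edge j i
  edge-sym i j = begin
    a ∧ b ∧ ¬i≡j    ≡⟨ sym (∧-assoc a b _) ⟩
    (a ∧ b) ∧ ¬i≡j  ≡⟨ cong₂ _∧_ (∧-comm a b) (cong not (does-⇔ (mk⇔ sym sym) (i Fin.≟ j) (j Fin.≟ i))) ⟩
    (b ∧ a) ∧ ¬j≡i  ≡⟨ ∧-assoc b a _ ⟩
    b ∧ a ∧ ¬j≡i    ∎
    where
    open ≡-Reasoning
    a b ¬i≡j ¬j≡i : Bool
    a = does (toℕ i <? m)
    b = does (toℕ j <? m)
    ¬i≡j = not (does (i Fin.≟ j))
    ¬j≡i = not (does (j Fin.≟ i))

  edge-irrefl : ∀ i → edge i i ≡ false
  edge-irrefl i rewrite dec-true (i Fin.≟ i) refl | ∧-zeroʳ (does (toℕ i <? m)) = ∧-zeroʳ _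

clique-below : ∀ {m M} {i j : Fin M} → adj (clique m M) i j ≡ true → toℕ i < m
clique-below {m} {i = i} ij = <ᵇ⇒< (toℕ i) m (Equivalence.from T-≡ (∧-conicalˡ _ _ ij))

clique-hom-pos : ∀ T M → n T ≤ M → 1 ≤ hom T (clique (n T) M)
clique-hom-pos T M vT≤M = hom-pos T (clique (n T) M) embed embed-hom
  where
  embed : Fin (n T) → Fin M
  embed i = Fin.inject≤ i vT≤M

  embed-below : ∀ i → toℕ (embed i) < n T
  embed-below i = subst (_< n T) (sym (toℕ-inject≤ i vT≤M)) (toℕ<n i)

  embed-hom : Homomorphism T (clique (n T) M) embed
  embed-hom i j ij
    rewrite dec-true (toℕ (embed i) <? n T) (embed-below i)
          | dec-true (toℕ (embed j) <? n T) (embed-below j)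
          | dec-false (embed i Fin.≟ embed j) (adj⇒≢ T ij ∘ inject≤-injective vT≤M vT≤M i j)
    = refl

clique-hom-≤ : ∀ H m M → (∀ i → ∃ λ j → adj H i j ≡ true) → hom H (clique m M) ≤ m ^ n H
clique-hom-≤ H m M neighbour = hom-≤ H (clique m M) m
  (λ f f-hom i → clique-below (f-hom i (proj₁ (neighbour i)) (proj₂ (neighbour i))))

-- Walks and cycles

module Walks (G : Graph) where

  private
    V : Set
    V = Fin (n G)

  len : ∀ {x y} → Walk G x y → ℕ
  len here       = 0
  len (step _ p) = suc (len p)

  _++ʷ_ : ∀ {x y z} → Walk G x y → Walk G y z → Walk G x z
  here       ++ʷ q = q
  step xy p ++ʷ q = step xy (p ++ʷ q)

  reverse : ∀ {x y} → Walk G x y → Walk G y x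
  reverse here                    = here
  reverse (step {i} {j} ij p) = reverse p ++ʷ step (trans (Graph.sym G j i) ij) here

  Steps : (V → V → Set) → ∀ {x y} → Walk G x y → Set
  Steps Q here                = ⊤
  Steps Q (step {i} {j} _ p) = Q i j × Steps Q p

  Steps-++ : ∀ {Q x y z} (p : Walk G x y) (q : Walk G y z) → Steps Q p → Steps Q q → Steps Q (p ++ʷ q)
  Steps-++ here       q _          Qq = Qq
  Steps-++ (step _ p) q (Qxy , Qp) Qq = Qxy , Steps-++ p q Qp Qq

  Steps-reverse : ∀ {Q} → (∀ {a b} → Q a b → Q b a) → ∀ {x y} (p : Walk G x y) → Steps Q p → Steps Q (reverse p)
  Steps-reverse Q-sym here       _          = tt
  Steps-reverse Q-sym (step _ p) (Qxy , Qp) = Steps-++ (reverse p) _ (Steps-reverse Q-sym p Qp) (Q-sym Qxy , tt)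

  Steps-map : ∀ {Q R} → (∀ {a b} → Q a b → R a b) → ∀ {x y} (p : Walk G x y) → Steps Q p → Steps R p
  Steps-map Q⇒R here       _          = tt
  Steps-map Q⇒R (step _ p) (Qxy , Qp) = Q⇒R Qxy , Steps-map Q⇒R p Qp

  vertex : ∀ {x y} (p : Walk G x y) → Fin (suc (len p)) → V
  vertex {x} p          Fin.zero    = x
  vertex     (step _ p) (Fin.suc i) = vertex p i

  vertex-last : ∀ {x y} (p : Walk G x y) → vertex p (fromℕ (len p)) ≡ y
  vertex-last here       = refl
  vertex-last (step _ p) = vertex-last p

  vertex-adj : ∀ {x y} (p : Walk G x y) (i : Fin (len p)) → adj G (vertex p (inject₁ i)) (vertex p (Fin.suc i)) ≡ true
  vertex-adj (step xy p) Fin.zero    = xy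
  vertex-adj (step _  p) (Fin.suc i) = vertex-adj p i

  Simple : ∀ {x y} → Walk G x y → Set
  Simple here                = ⊤
  Simple {x} (step _ p) = (∀ i → vertex p i ≢ x) × Simple p

  vertex-injective : ∀ {x y} (p : Walk G x y) → Simple p → ∀ a b → vertex p a ≡ vertex p b → a ≡ b
  vertex-injective p          _              Fin.zero    Fin.zero    _  = refl
  vertex-injective (step _ p) (fresh , _)    Fin.zero    (Fin.suc b) eq = ⊥-elim (fresh b (sym eq))
  vertex-injective (step _ p) (fresh , _)    (Fin.suc a) Fin.zero    eq = ⊥-elim (fresh a eq)
  vertex-injective (step _ p) (_ , simple-p) (Fin.suc a) (Fin.suc b) eq = cong Fin.suc (vertex-injective p simple-p a b eq)

  module _ (Q : V → V → Set) where

    suffix : ∀ {a y} (q : Walk G a y) → Simple q → ∀ i →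
      Σ (Walk G (vertex q i) y) λ q′ → Simple q′ × (Steps Q q → Steps Q q′)
    suffix q          simple-q     Fin.zero    = q , simple-q , id
    suffix (step _ q) (_ , simple) (Fin.suc i) with suffix q simple i
    ... | q′ , simple′ , keep = q′ , simple′ , keep ∘ proj₂

    shortcut : ∀ {x y} (p : Walk G x y) → Σ (Walk G x y) λ q → Simple q × (Steps Q p → Steps Q q)
    shortcut here = here , tt , id
    shortcut {x} (step xy p) with shortcut p
    ... | q , simple-q , keep with any? (λ i → vertex q i Fin.≟ x)
    ...   | yes (i , refl) with suffix q simple-q i
    ...     | q′ , simple′ , keep′ = q′ , simple′ , keep′ ∘ keep ∘ proj₂
    shortcut {x} (step xy p) | q , simple-q , keep | no x∉q =
      step xy q , ((λ i eq → x∉q (i , eq)) , simple-q) , λ (Qxy , Qp) → Qxy , keep Qp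

  simple-cycle : ∀ {u w} (p : Walk G u w) → Simple p → 2 ≤ len p → adj G w u ≡ true → HasCycle G
  simple-cycle p@(step _ (step _ q)) simple-p _ wu =
    len q , vertex p , (λ {a} {b} → vertex-injective p simple-p a b) , vertex-adj p ,
    subst (λ z → adj G z _ ≡ true) (sym (vertex-last p)) wu
  simple-cycle (step _ here) _ (s≤s ()) _

  OtherEdge : V → V → V → V → Set
  OtherEdge u w a b = ¬ ((a ≡ u × b ≡ w) ⊎ (a ≡ w × b ≡ u))

  acyclic⇒no-detour : ¬ HasCycle G → ∀ {u w} → adj G u w ≡ true → (p : Walk G u w) → ¬ Steps (OtherEdge u w) p
  acyclic⇒no-detour acyclic {u} {w} uw p avoids with shortcut (OtherEdge u w) p
  ... | here , _ , _ = adj⇒≢ G uw refl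
  ... | step _ here , _ , keep = proj₁ (keep avoids) (inj₁ (refl , refl))
  ... | q@(step _ (step _ _)) , simple-q , _ = acyclic (simple-cycle q simple-q (s≤s (s≤s z≤n)) (trans (Graph.sym G w u) uw))

-- Distance layers and the edge count of a tree

module _ (P : ℕ → Bool) where

  private
    Least : Set
    Least = Σ ℕ λ k → P k ≡ true × (∀ m → P m ≡ true → k ≤ m)

    search : ∀ n → Least ⊎ (∀ m → m < n → P m ≡ false)
    search zero    = inj₂ (λ _ ())
    search (suc n) with search n
    ... | inj₁ least = inj₁ least
    ... | inj₂ below with P n in Pn
    ...   | true  = inj₁ (n , Pn , λ m Pm → ≮⇒≥ (λ m<n → contradiction (trans (sym Pm) (below m m<n)) λ ()))
    ...   | false = inj₂ (λ m m<1+n → [ below m , (λ { refl → Pn }) ]′ (m<1+n⇒m<n∨m≡n m<1+n))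

  least-true : ∀ n → P n ≡ true → Σ ℕ λ k → P k ≡ true × (∀ m → P m ≡ true → k ≤ m)
  least-true n Pn with search (suc n)
  ... | inj₁ least = least
  ... | inj₂ below with () ← trans (sym Pn) (below n ≤-refl)

module Depth (G : Graph) (connected : Connected G) (r : Fin (n G)) where

  open Walks G

  private
    V : Set
    V = Fin (n G)

    ∧-true⁻ : ∀ {a b} → T (a ∧ b) → a ≡ true × b ≡ true
    ∧-true⁻ {true} {true} _ = refl , refl

  within : ℕ → V → Bool
  within zero    i = does (i Fin.≟ r)
  within (suc k) i = within k i ∨ does (any? λ j → T? (adj G i j ∧ within k j))

  within-root : within 0 r ≡ true
  within-root = dec-true (r Fin.≟ r) refl

  within-zero⁻ : ∀ {i} → within 0 i ≡ true → i ≡ r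
  within-zero⁻ {i} w with i Fin.≟ r
  ... | yes i≡r = i≡r

  within-step : ∀ k {i j} → adj G i j ≡ true → within k j ≡ true → within (suc k) i ≡ true
  within-step k {i} {j} ij wj with within k i
  ... | true  = refl
  ... | false = dec-true (any? λ j → T? (adj G i j ∧ within k j)) (j , subst T (sym (cong₂ _∧_ ij wj)) tt)

  within-suc⁻ : ∀ k {i} → within (suc k) i ≡ true →
    within k i ≡ true ⊎ ∃ λ j → adj G i j ≡ true × within k j ≡ true
  within-suc⁻ k {i} w with within k i | any? (λ j → T? (adj G i j ∧ within k j))
  ... | true  | _             = inj₁ refl
  ... | false | yes (j , ijk) = inj₂ (j , ∧-true⁻ ijk)

  within-walk : ∀ {i} (p : Walk G i r) → within (len p) i ≡ true
  within-walk here        = within-root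
  within-walk (step ij p) = within-step (len p) ij (within-walk p)

  private
    shortest : ∀ i → Σ ℕ λ k → within k i ≡ true × (∀ m → within m i ≡ true → k ≤ m)
    shortest i = least-true (λ k → within k i) (len (connected i r)) (within-walk (connected i r))

  depth : V → ℕ
  depth i = proj₁ (shortest i)

  depth-within : ∀ i → within (depth i) i ≡ true
  depth-within i = proj₁ (proj₂ (shortest i))

  depth-least : ∀ i m → within m i ≡ true → depth i ≤ m
  depth-least i = proj₂ (proj₂ (shortest i))

  depth-root : depth r ≡ 0
  depth-root = ≤-antisym (depth-least r 0 within-root) z≤n

  depth-adj : ∀ {i j} → adj G i j ≡ true → depth i ≤ suc (depth j)
  depth-adj {i} {j} ij = depth-least i (suc (depth j)) (within-step (depth j) ij (depth-within j))

  Descending : V → V → Set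
  Descending a b = suc (depth b) ≡ depth a

  parent : ∀ i → i ≢ r → ∃ λ j → adj G i j ≡ true × Descending i j
  parent i i≢r = go (depth i) refl
    where
    go : ∀ k → depth i ≡ k → ∃ λ j → adj G i j ≡ true × Descending i j
    go zero    d≡0 = ⊥-elim (i≢r (within-zero⁻ (subst (λ k → within k i ≡ true) d≡0 (depth-within i))))
    go (suc k) d≡1+k with within-suc⁻ k (subst (λ k → within k i ≡ true) d≡1+k (depth-within i))
    ... | inj₁ wk = ⊥-elim (1+n≰n (subst (_≤ k) d≡1+k (depth-least i k wk)))
    ... | inj₂ (j , ij , wj) =
      j , ij , ≤-antisym (subst (suc (depth j) ≤_) (sym d≡1+k) (s≤s (depth-least j k wj))) (depth-adj ij)

  descent : ∀ x → Σ (Walk G x r) (Steps Descending)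
  descent x = go (depth x) x refl
    where
    go : ∀ k y → depth y ≡ k → Σ (Walk G y r) (Steps Descending)
    go zero    y d≡0 with within-zero⁻ {y} (subst (λ k → within k y ≡ true) d≡0 (depth-within y))
    ... | refl = here , tt
    go (suc k) y d≡1+k with parent y (λ { refl → contradiction (trans (sym depth-root) d≡1+k) λ () })
    ... | j , yj , desc with go k j (cong ℕ.pred (trans desc d≡1+k))
    ...   | p , desc-p = step yj p , desc , desc-p

  descent-below : ∀ {x y} (p : Walk G x y) → Steps Descending p →
    Steps (λ a b → depth a ≤ depth x × depth b ≤ depth x) p
  descent-below here _ = tt
  descent-below {x} (step {j = j} _ p) (desc , desc-p) =
    (≤-refl , j≤x) , Steps-map (λ (a≤j , b≤j) → ≤-trans a≤j j≤x , ≤-trans b≤j j≤x) p (descent-below p desc-p)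
    where
    j≤x : depth j ≤ depth x
    j≤x = subst (depth j ≤_) desc (n≤1+n (depth j))

+-double-injective : ∀ m n → m + m ≡ n + n → m ≡ n
+-double-injective m n eq =
  *-cancelˡ-≡ m n 2 (trans (cong (m +_) (+-identityʳ m)) (trans eq (cong (n +_) (sym (+-identityʳ n)))))

module TreeEdges (G : Graph) (connected : Connected G) (acyclic : ¬ HasCycle G) (r : Fin (n G)) where

  open Walks G
  open Depth G connected r
  open EdgeCount G using (handshake)

  private
    N : ℕ
    N = n G

    V : Set
    V = Fin N

  down : ∀ x → Walk G x r
  down x = proj₁ (descent x)

  down-descending : ∀ x → Steps Descending (down x)
  down-descending x = proj₂ (descent x)

  Descending-asym : ∀ {a b} → Descending a b → ¬ Descending b a
  Descending-asym {a} {b} ab ba = 1+n≰n (subst₂ _≤_ (sym ab) ba (n≤1+n (depth a)))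

  -- The walk u ⇝ r ⇝ w changes layer at every step, so it avoids an edge u–w inside a layer.
  no-edge-within-level : ∀ {u w} → adj G u w ≡ true → depth u ≢ depth w
  no-edge-within-level {u} {w} uw u~w = acyclic⇒no-detour acyclic uw (down u ++ʷ reverse (down w))
    (Steps-map level-change⇒other _
      (Steps-++ (down u) _ (Steps-map desc⇒change _ (down-descending u))
                           (Steps-reverse (λ ne → ne ∘ sym) (down w) (Steps-map desc⇒change _ (down-descending w)))))
    where
    desc⇒change : ∀ {a b} → Descending a b → depth a ≢ depth b
    desc⇒change ab a~b = 1+n≢n (trans ab a~b)
    level-change⇒other : ∀ {a b} → depth a ≢ depth b → OtherEdge u w a b
    level-change⇒other a≁b (inj₁ (refl , refl)) = a≁b u~w
    level-change⇒other a≁b (inj₂ (refl , refl)) = a≁b (sym u~w)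

  adjacent-depths : ∀ {i j} → adj G i j ≡ true → Descending i j ⊎ Descending j i
  adjacent-depths {i} {j} ij with <-cmp (depth i) (depth j)
  ... | tri< i<j _ _ = inj₂ (≤-antisym i<j (depth-adj (trans (Graph.sym G j i) ij)))
  ... | tri≈ _ i~j _ = ⊥-elim (no-edge-within-level ij i~j)
  ... | tri> _ _ j<i = inj₁ (≤-antisym j<i (depth-adj ij))

  unique-parent : ∀ {i p q} → adj G i p ≡ true → Descending i p → adj G i q ≡ true → Descending i q → q ≡ p
  -- The walk i → q ⇝ r ⇝ p stays below the layer of i after its first step, so it avoids the edge i–p.
  unique-parent {i} {p} {q} ip desc-p iq desc-q with q Fin.≟ p
  ... | yes q≡p = q≡p
  ... | no  q≢p = ⊥-elim (acyclic⇒no-detour acyclic ip (step iq (down q ++ʷ reverse (down p)))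
          (first , Steps-map avoids⇒other _ (Steps-++ (down q) _ (below⇒avoids desc-q (down q) (down-descending q))
            (Steps-reverse (λ (a≢i , b≢i) → b≢i , a≢i) (down p) (below⇒avoids desc-p (down p) (down-descending p))))))
    where
    Avoids : V → V → Set
    Avoids a b = a ≢ i × b ≢ i

    first : OtherEdge i p i q
    first (inj₁ (_ , q≡p)) = q≢p q≡p
    first (inj₂ (i≡p , _)) = adj⇒≢ G ip i≡p

    avoids⇒other : ∀ {a b} → Avoids a b → OtherEdge i p a b
    avoids⇒other (a≢i , _) (inj₁ (a≡i , _)) = a≢i a≡i
    avoids⇒other (_ , b≢i) (inj₂ (_ , b≡i)) = b≢i b≡i

    below⇒avoids : ∀ {x} → Descending i x → (p : Walk G x r) → Steps Descending p → Steps Avoids p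
    below⇒avoids {x} ix p desc = Steps-map avoid p (descent-below p desc)
      where
      not-i : ∀ {a} → depth a ≤ depth x → a ≢ i
      not-i a≤x refl = 1+n≰n (subst (_≤ depth x) (sym ix) a≤x)
      avoid : ∀ {a b} → depth a ≤ depth x × depth b ≤ depth x → Avoids a b
      avoid (a≤x , b≤x) = not-i a≤x , not-i b≤x

  is-parent : V → V → Bool
  is-parent i j = adj G i j ∧ does (suc (depth j) ℕ.≟ depth i)

  adj≡parent+child : ∀ i j → [ adj G i j ] ≡ [ is-parent i j ] + [ is-parent j i ]
  adj≡parent+child i j with adj G i j in ij
  ... | false rewrite Graph.sym G j i | ij = refl
  ... | true with adjacent-depths ij
  ...   | inj₁ desc rewrite Graph.sym G j i | ij
                          | dec-true (suc (depth j) ℕ.≟ depth i) desc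
                          | dec-false (suc (depth i) ℕ.≟ depth j) (Descending-asym desc) = refl
  ...   | inj₂ desc rewrite Graph.sym G j i | ij
                          | dec-false (suc (depth j) ℕ.≟ depth i) (Descending-asym desc)
                          | dec-true (suc (depth i) ℕ.≟ depth j) desc = refl

  parents : V → ℕ
  parents i = ∑[ j < N ] [ is-parent i j ]

  root-parents : parents r ≡ 0
  root-parents = ∑-zero no-parent
    where
    no-parent : ∀ j → [ is-parent r j ] ≡ 0
    no-parent j rewrite dec-false (suc (depth j) ℕ.≟ depth r) (λ eq → 1+n≢0 (trans eq depth-root))
                      | ∧-zeroʳ (adj G r j) = refl

  nonroot-parents : ∀ i → i ≢ r → parents i ≡ 1
  nonroot-parents i i≢r with parent i i≢r
  ... | p , ip , desc-p = trans (∑-single _ p only-p) at-p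
    where
    at-p : [ is-parent i p ] ≡ 1
    at-p rewrite ip | dec-true (suc (depth p) ℕ.≟ depth i) desc-p = refl
    only-p : ∀ j → j ≢ p → [ is-parent i j ] ≡ 0
    only-p j j≢p with adj G i j in ij
    ... | false = refl
    ... | true rewrite dec-false (suc (depth j) ℕ.≟ depth i) (j≢p ∘ unique-parent ip desc-p ij) = refl

  edges : suc (e G) ≡ N
  edges = trans (cong suc (+-double-injective (e G) S e+e≡S+S)) S+1≡N
    where
    S : ℕ
    S = ∑[ i < N ] parents i

    S+1≡N : suc S ≡ N
    S+1≡N = ∑-all-but-one parents r root-parents nonroot-parents

    e+e≡S+S : e G + e G ≡ S + S
    e+e≡S+S = begin
      e G + e G
        ≡⟨ sym handshake ⟩
      ∑[ i < N ] ∑[ j < N ] [ adj G i j ]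
        ≡⟨ sum-cong-≗ (λ i → sum-cong-≗ (adj≡parent+child i)) ⟩
      ∑[ i < N ] ∑[ j < N ] ([ is-parent i j ] + [ is-parent j i ])
        ≡⟨ sum-cong-≗ (λ i → ∑-distrib-+ (λ j → [ is-parent i j ]) _) ⟩
      ∑[ i < N ] (parents i + ∑[ j < N ] [ is-parent j i ])
        ≡⟨ ∑-distrib-+ parents _ ⟩
      S + ∑[ i < N ] ∑[ j < N ] [ is-parent j i ]
        ≡⟨ cong (S +_) (∑-comm (λ i j → [ is-parent j i ])) ⟩
      S + S ∎
      where open ≡-Reasoning

tree-edges : ∀ G → Tree G → Fin (n G) → suc (e G) ≡ v G
tree-edges G (connected , acyclic) r = TreeEdges.edges G connected acyclic r

-- The comparison on a padded clique

exponent-split : ∀ a δ → suc a * suc (a + δ) ≡ suc δ + suc (suc (a + δ)) * a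
exponent-split = solve-∀

-- The exponents differ by h b − t a = b − a > 0, and M exceeds t ^ (h b) ≥ y ^ b.
power-gap : ∀ {a b h t x y} → suc a ≡ h → suc b ≡ t → h < t → 1 ≤ x → y ≤ t ^ h →
  let M = t + t ^ (h * b) in y ^ b * M ^ (t * a) < x ^ a * M ^ (h * b)
power-gap {a} {b} {x = x} {y} refl refl h<t 1≤x y≤tʰ with m≤n⇒∃[o]m+o≡n (≤-pred h<t)
... | δ , refl = begin-strict
  y ^ b * M ^ (t * a)        ≤⟨ *-monoˡ-≤ (M ^ (t * a)) yᵇ≤X ⟩
  X * M ^ (t * a)            <⟨ *-monoˡ-< (M ^ (t * a)) ⦃ m^n≢0 M (t * a) ⦄ (m<n+m X {t} z<s) ⟩
  M * M ^ (t * a)            ≤⟨ *-monoˡ-≤ (M ^ (t * a)) (m≤m*n M (M ^ δ) ⦃ m^n≢0 M δ ⦄) ⟩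
  M ^ suc δ * M ^ (t * a)    ≡⟨ sym (^-distribˡ-+-* M (suc δ) (t * a)) ⟩
  M ^ (suc δ + t * a)        ≡⟨ cong (M ^_) (sym (exponent-split a δ)) ⟩
  M ^ (h * b)                ≤⟨ m≤n*m (M ^ (h * b)) (x ^ a) ⦃ xᵃ≢0 ⦄ ⟩
  x ^ a * M ^ (h * b)        ∎
  where
  open ≤-Reasoning
  h t X M : ℕ
  h = suc a
  t = suc b
  X = t ^ (h * b)
  M = t + X
  yᵇ≤X : y ^ b ≤ X
  yᵇ≤X = subst (y ^ b ≤_) (^-*-assoc t h b) (^-monoˡ-≤ b y≤tʰ)
  xᵃ≢0 : ℕ.NonZero (x ^ a)
  xᵃ≢0 = ℕ.>-nonZero (subst (_≤ x ^ a) (^-zeroˡ a) (^-monoˡ-≤ a 1≤x))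

nonempty-vertex : ∀ G → NonEmpty G → Fin (v G)
nonempty-vertex G 1≤e = index (subst (1 ≤_) (EdgeCount.e-as-∑ G) 1≤e)
  where
  index : ∀ {k} {f : Fin k → ℕ} → 1 ≤ ∑ f → Fin k
  index {suc k} _ = Fin.zero

connected⇒neighbour : ∀ G → Connected G → 2 ≤ v G → ∀ i → ∃ λ j → adj G i j ≡ true
connected⇒neighbour G connected 2≤v i = first-step (connected i (proj₁ (other i 2≤v))) (proj₂ (other i 2≤v))
  where
  other : ∀ {k} (i : Fin k) → 2 ≤ k → ∃ λ j → i ≢ j
  other {suc (suc k)} Fin.zero    _ = Fin.suc Fin.zero , λ ()
  other {suc (suc k)} (Fin.suc i) _ = Fin.zero , λ ()
  other {suc zero}    Fin.zero    (s≤s ())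

  first-step : ∀ {x y} → Walk G x y → x ≢ y → ∃ λ k → adj G x k ≡ true
  first-step here        x≢x = ⊥-elim (x≢x refl)
  first-step (step xk _) _   = _ , xk

corollary5p2 : (H T : Graph) → NonEmpty H → NonEmpty T → Tree H → Tree T →
    H ≽ T → v H ≥ v T
corollary5p2 H T neH neT treeH treeT H≽T with v T ℕ.≤? v H
... | yes vT≤vH = vT≤vH
... | no  vT≰vH = contradiction (H≽T G) (<⇒≱ gap)
  where
  eH : suc (e H) ≡ v H
  eH = tree-edges H treeH (nonempty-vertex H neH)
  eT : suc (e T) ≡ v T
  eT = tree-edges T treeT (nonempty-vertex T neT)
  neighbour : ∀ i → ∃ λ j → adj H i j ≡ true
  neighbour = connected⇒neighbour H (proj₁ treeH) (subst (2 ≤_) eH (s≤s neH))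
  M : ℕ
  M = v T + v T ^ (v H * e T)
  G : Graph
  G = clique (v T) M
  gap : hom H G ^ e T * M ^ (v T * e H) < hom T G ^ e H * M ^ (v H * e T)
  gap = power-gap eH eT (≰⇒> vT≰vH) (clique-hom-pos T M (m≤m+n (v T) _)) (clique-hom-≤ H (v T) M neighbour)
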